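{- Let $G$ be a chordal graph and $T\subseteq V(G)$ such that no connected component of $G$ is a clique, $G$ has no bridge, and every non-terminal vertex of $G$ (vertex not in $T$) has a neighbour in $T$. Then every vertex of $G$ is contained in some $T$-triangle.
   Context: A graph is chordal if every cycle of length at least four has a chord. A bridge is an edge contained in no cycle. A $T$-triangle is a triangle containing at least one vertex of $T$. -}

module Defs where

open import Data.Nat using (ℕ; suc; _≤_)
open import Data.Fin using (Fin; toℕ)
open import Data.Fin.Subset using (Subset; _∈_; _∉_)
open import Data.Bool using (Bool; true)
open import Data.Product using (Σ; _×_; ∃; ∃-syntax)
open import Data.Sum using (_⊎_)
open import Data.Empty using (⊥)
open import Relation.Nullary using (¬_)
open import Relation.Binary.PropositionalEquality using (_≡_; _≢_)
open import Relation.Binary.Construct.Closure.ReflexiveTransitive using (Star)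
open import Function.Definitions using (Injective)

record Graph (n : ℕ) : Set where
  field
    adj     : Fin n → Fin n → Bool
    symm    : ∀ u v → adj u v ≡ adj v u
    irrefl  : ∀ v → adj v v ≡ true → ⊥
  Adj : Fin n → Fin n → Set
  Adj u v = adj u v ≡ true

module _ {n : ℕ} (G : Graph n) where
  open Graph G

  Consec : (k : ℕ) → Fin k → Fin k → Set
  Consec k i j = (suc (toℕ i) ≡ toℕ j) ⊎ (suc (toℕ i) ≡ k × toℕ j ≡ 0)

  record Cycle : Set where
    field
      len    : ℕ
      len≥3  : 3 ≤ len
      vert   : Fin len → Fin n
      inj    : Injective _≡_ _≡_ vert
      edges  : ∀ i j → Consec len i j → Adj (vert i) (vert j)

  HasChord : Cycle → Set
  HasChord C = ∃[ i ] ∃[ j ] (i ≢ j × ¬ Consec len i j × ¬ Consec len j i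
                               × Adj (vert i) (vert j))
    where open Cycle C

  Chordal : Set
  Chordal = (C : Cycle) → 4 ≤ Cycle.len C → HasChord C

  EdgeOnCycle : Fin n → Fin n → Cycle → Set
  EdgeOnCycle u v C = ∃[ i ] ∃[ j ] (Consec len i j ×
                         ((vert i ≡ u × vert j ≡ v) ⊎ (vert i ≡ v × vert j ≡ u)))
    where open Cycle C

  IsBridge : Fin n → Fin n → Set
  IsBridge u v = Adj u v × ¬ (Σ Cycle (EdgeOnCycle u v))

  HasBridge : Set
  HasBridge = ∃[ u ] ∃[ v ] IsBridge u v

  Connected : Fin n → Fin n → Set
  Connected = Star Adj

  ComponentIsClique : Fin n → Set
  ComponentIsClique v = ∀ x y → Connected v x → Connected v y → x ≢ y → Adj x y

  NoComponentIsClique : Set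
  NoComponentIsClique = ∀ v → ¬ ComponentIsClique v

  Dominated : Subset n → Set
  Dominated T = ∀ v → v ∉ T → ∃[ u ] (Adj v u × u ∈ T)

  -- v lies in a triangle {v,a,b} containing at least one vertex of T
  -- (distinctness follows from irreflexivity of adjacency)
  InTTriangle : Subset n → Fin n → Set
  InTTriangle T v = ∃[ a ] ∃[ b ] (Adj v a × Adj v b × Adj a b
                       × (v ∈ T ⊎ a ∈ T ⊎ b ∈ T))

-- Take an edge vu with an endpoint in T: if v ∉ T it comes from domination, and if
-- v ∈ T then v is not isolated, since otherwise its component {v} would be a clique.
-- As vu is not a bridge it lies on a cycle, and in a chordal graph the two ends of an
-- edge on a cycle have a common neighbour w: a chord of a cycle of length at least
-- four can be used to cut off a part of the cycle not containing the edge, and a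
-- triangle is reached eventually. Then {v, u, w} is a T-triangle.
module Submission where

open import Data.Bool using (true)
open import Data.Bool.Properties using (_≟_)
open import Data.Empty using (⊥-elim)
open import Data.Fin using (Fin; zero; suc; toℕ; fromℕ)
open import Data.Fin.Properties using (toℕ-fromℕ; toℕ-injective; any?)
open import Data.Fin.Subset using (Subset; _∈_)
open import Data.Fin.Subset.Properties using (_∈?_)
open import Data.List using (List; []; _∷_; _++_; length; lookup; tabulate; head; last)
open import Data.List.Properties using (length-++-comm; length-++-≤ʳ; length-tabulate)
import Data.List.Relation.Binary.Permutation.Setoid.Properties as Permutation
open import Data.List.Membership.Propositional.Properties using (∈-lookup)
open import Data.List.Relation.Unary.All as All using (All; _∷_)
import Data.List.Relation.Unary.All.Properties as Allₚ
open import Data.List.Relation.Unary.AllPairs using (AllPairs; _∷_)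
open import Data.List.Relation.Unary.Linked as Linked using (Linked; []; [-]; _∷_)
import Data.List.Relation.Unary.Linked.Properties as Linked
open import Data.List.Relation.Unary.Unique.Propositional using (Unique)
open import Data.List.Relation.Unary.Unique.Propositional.Properties using (tabulate⁺)
open import Data.Maybe using (just)
open import Data.Maybe.Properties using (just-injective)
import Data.Maybe.Relation.Binary.Connected as Maybe
open import Data.Nat using (ℕ; zero; suc; pred; _+_; _≤_; _<_; z≤n; s≤s)
open import Data.Nat.Induction using (<-wellFounded)
open import Data.Nat.Properties using (<-cmp; +-identityʳ; ≤-trans)
open import Data.Product using (Σ; _×_; _,_; ∃; ∃₂; ∃-syntax)
open import Data.Sum using (_⊎_; inj₁; inj₂; map₂)
open import Defs
open import Induction.WellFounded using (Acc; acc)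
open import Level using (Level)
open import Relation.Binary.Core using (Rel)
open import Relation.Binary.Definitions using (tri<; tri≈; tri>)
open import Relation.Binary.Construct.Closure.ReflexiveTransitive using (ε; _◅_)
open import Relation.Binary.PropositionalEquality
open import Relation.Nullary using (¬_; Dec; yes; no)
open import Relation.Nullary.Decidable using (_×-dec_)
open import Relation.Unary using (Pred)

module _ {a : Level} {X : Set a} where

  head-++-∷ : ∀ (A : List X) {x Y Z} → head (A ++ x ∷ Y) ≡ head (A ++ x ∷ Z)
  head-++-∷ []      = refl
  head-++-∷ (_ ∷ _) = refl

  last-++-∷ : ∀ (A : List X) {x Y} → last (A ++ x ∷ Y) ≡ last (x ∷ Y)
  last-++-∷ []          = refl
  last-++-∷ (_ ∷ [])    = refl
  last-++-∷ (_ ∷ y ∷ A) = last-++-∷ (y ∷ A)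

  last-++ʳ : ∀ (A : List X) {B x} → last B ≡ just x → last (A ++ B) ≡ just x
  last-++ʳ A {_ ∷ _} eq = trans (last-++-∷ A) eq

  head-lookup : ∀ {L : List X} {x} → head L ≡ just x → ∀ i → toℕ i ≡ 0 → lookup L i ≡ x
  head-lookup {_ ∷ _} eq zero _ = just-injective eq

  last-lookup : ∀ {L : List X} {x} → last L ≡ just x →
                ∀ i → suc (toℕ i) ≡ length L → lookup L i ≡ x
  last-lookup {_ ∷ []}    eq zero    _  = just-injective eq
  last-lookup {_ ∷ _ ∷ _} eq (suc i) i+1≡ = last-lookup eq i (cong pred i+1≡)

  lookup-injective : ∀ {L : List X} → Unique L → ∀ {i j} → lookup L i ≡ lookup L j → i ≡ j
  lookup-injective (_  ∷ _)  {zero}  {zero}  _  = refl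
  lookup-injective (x∉ ∷ _)  {zero}  {suc j} eq with () ← All.lookup x∉ (∈-lookup j) eq
  lookup-injective (x∉ ∷ _)  {suc i} {zero}  eq with () ← All.lookup x∉ (∈-lookup i) (sym eq)
  lookup-injective (_  ∷ un) {suc i} {suc j} eq = cong suc (lookup-injective un eq)

  Unique-++-comm : ∀ (A : List X) {B} → Unique (A ++ B) → Unique (B ++ A)
  Unique-++-comm A {B} = Unique-resp-↭ (++-comm A B)
    where open Permutation (setoid X)

  last-tabulate : ∀ {k} (f : Fin k → X) i → suc (toℕ i) ≡ k → last (tabulate f) ≡ just (f i)
  last-tabulate {suc zero}    f zero    _   = refl
  last-tabulate {suc (suc _)} f (suc i) i+1≡ = last-tabulate (λ x → f (suc x)) i (cong pred i+1≡)

  tabulate-split : ∀ {k} (f : Fin k → X) i j → suc (toℕ i) ≡ toℕ j →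
                   ∃₂ λ A B → tabulate f ≡ A ++ B × last A ≡ just (f i) × head B ≡ just (f j)
  tabulate-split {suc (suc _)} f zero (suc zero) _ =
    f zero ∷ [] , tabulate (λ x → f (suc x)) , refl , refl , refl
  tabulate-split {suc (suc _)} f (suc i) (suc j) i+1≡j
    with A , B , eq , lastA , headB ← tabulate-split (λ x → f (suc x)) i j (cong pred i+1≡j) =
    f zero ∷ A , B , cong (f zero ∷_) eq , last-++ʳ (f zero ∷ []) {A} lastA , headB

  split-at : (L : List X) (i : Fin (length L)) →
             ∃₂ λ A C → L ≡ A ++ lookup L i ∷ C × toℕ i ≡ length A
                                                × length L ≡ suc (toℕ i + length C)
  split-at (x ∷ L) zero = [] , L , refl , refl , refl
  split-at (x ∷ L) (suc i) with A , C , eq , i≡ , len≡ ← split-at L i =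
    x ∷ A , C , cong (x ∷_) eq , cong suc i≡ , cong suc len≡

  split-at-< : (L : List X) (i j : Fin (length L)) → toℕ i < toℕ j →
               ∃₂ λ A B → ∃ λ C → L ≡ A ++ lookup L i ∷ B ++ lookup L j ∷ C
                 × toℕ i ≡ length A × toℕ j ≡ suc (toℕ i + length B)
                 × length L ≡ suc (toℕ j + length C)
  split-at-< (x ∷ L) zero (suc j) _ with B , C , eq , j≡ , len≡ ← split-at L j =
    [] , B , C , cong (x ∷_) eq , refl , cong suc j≡ , cong suc len≡
  split-at-< (x ∷ L) (suc i) (suc j) (s≤s i<j)
    with A , B , C , eq , i≡ , j≡ , len≡ ← split-at-< L i j i<j =
    x ∷ A , B , C , cong (x ∷_) eq , cong suc i≡ , cong suc j≡ , cong suc len≡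

  length-deleteBlock-< : ∀ (A : List X) {x y B z C} →
                         length (A ++ x ∷ z ∷ C) < length (A ++ x ∷ y ∷ B ++ z ∷ C)
  length-deleteBlock-< []    {B = B} = s≤s (s≤s (length-++-≤ʳ _ {B}))
  length-deleteBlock-< (_ ∷ A)       = s≤s (length-deleteBlock-< A)

  module _ {p : Level} {P : Pred X p} where

    All-deleteBlock : ∀ A {x} B {C} → All P (A ++ x ∷ B ++ C) → All P (A ++ x ∷ C)
    All-deleteBlock []      B (px ∷ ps) = px ∷ Allₚ.++⁻ʳ B ps
    All-deleteBlock (_ ∷ A) B (pa ∷ ps) = pa ∷ All-deleteBlock A B ps

  module _ {ℓ : Level} {R : Rel X ℓ} where

    AllPairs-++⁻ʳ : ∀ A {B} → AllPairs R (A ++ B) → AllPairs R B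
    AllPairs-++⁻ʳ []      rs       = rs
    AllPairs-++⁻ʳ (_ ∷ A) (_ ∷ rs) = AllPairs-++⁻ʳ A rs

    AllPairs-deleteBlock : ∀ A {x} B {C} → AllPairs R (A ++ x ∷ B ++ C) → AllPairs R (A ++ x ∷ C)
    AllPairs-deleteBlock []      B (rx ∷ rs) = Allₚ.++⁻ʳ B rx ∷ AllPairs-++⁻ʳ B rs
    AllPairs-deleteBlock (_ ∷ A) B (ra ∷ rs) = All-deleteBlock A B ra ∷ AllPairs-deleteBlock A B rs

    Linked-++⁻ˡ : ∀ A {B} → Linked R (A ++ B) → Linked R A
    Linked-++⁻ˡ []          _        = []
    Linked-++⁻ˡ (_ ∷ [])    _        = [-]
    Linked-++⁻ˡ (_ ∷ y ∷ A) (r ∷ rs) = r ∷ Linked-++⁻ˡ (y ∷ A) rs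

    Linked-++⁻ʳ : ∀ A {B} → Linked R (A ++ B) → Linked R B
    Linked-++⁻ʳ []      rs = rs
    Linked-++⁻ʳ (_ ∷ A) rs = Linked-++⁻ʳ A (Linked.tail rs)

    Linked-shortcut : ∀ A {x y B z C} → Linked R (A ++ x ∷ y ∷ B ++ z ∷ C) → R x z →
                      Linked R (A ++ x ∷ z ∷ C)
    Linked-shortcut []          {B = B} (_ ∷ rs) rxz = rxz ∷ Linked-++⁻ʳ B (Linked.tail rs)
    Linked-shortcut (_ ∷ [])    (r ∷ rs) rxz = r ∷ Linked-shortcut [] rs rxz
    Linked-shortcut (_ ∷ y ∷ A) (r ∷ rs) rxz = r ∷ Linked-shortcut (y ∷ A) rs rxz

    Linked-lookup : ∀ {L} → Linked R L →
                    ∀ i j → suc (toℕ i) ≡ toℕ j → R (lookup L i) (lookup L j)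
    Linked-lookup (r ∷ _)  zero    (suc zero) _    = r
    Linked-lookup (_ ∷ rs) (suc i) (suc j)    i+1≡j = Linked-lookup rs i j (cong pred i+1≡j)

    Linked-tabulate : ∀ {k} {f : Fin k → X} → (∀ i j → suc (toℕ i) ≡ toℕ j → R (f i) (f j)) →
                      Linked R (tabulate f)
    Linked-tabulate {zero}        _ = []
    Linked-tabulate {suc zero}    _ = [-]
    Linked-tabulate {suc (suc _)} r =
      r zero (suc zero) refl ∷ Linked-tabulate (λ i j i+1≡j → r (suc i) (suc j) (cong suc i+1≡j))

module _ {n : ℕ} (G : Graph n) where
  open Graph G

  Adj-sym : ∀ {x y} → Adj x y → Adj y x
  Adj-sym {x} {y} = trans (symm y x)

  adj? : ∀ x y → Dec (Adj x y)
  adj? x y = adj x y ≟ true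

  CommonNeighbour : Fin n → Fin n → Set
  CommonNeighbour x y = ∃[ w ] (Adj x w × Adj y w)

  commonNeighbour? : ∀ x y → Dec (CommonNeighbour x y)
  commonNeighbour? x y = any? λ w → adj? x w ×-dec adj? y w

  -- A cycle through the edge v u, listed from u round to v.
  record Path (u v : Fin n) : Set where
    field
      vertices : List (Fin n)
      unique   : Unique vertices
      linked   : Linked Adj vertices
      head≡    : head vertices ≡ just u
      last≡    : last vertices ≡ just v
      3≤length : 3 ≤ length vertices

    size : ℕ
    size = length vertices

  open Path

  ShorterPath : ∀ {u v} → Path u v → Set
  ShorterPath {u} {v} p = Σ (Path u v) λ q → size q < size p

  Path⇒Cycle : ∀ {u v} → Path u v → Adj v u → Cycle G
  Path⇒Cycle p vu = record
    { len = size p ; len≥3 = 3≤length p ; vert = lookup (vertices p)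
    ; inj = lookup-injective {L = vertices p} (unique p) ; edges = edges }
    where
    edges : ∀ i j → Consec G (size p) i j → Adj (lookup (vertices p) i) (lookup (vertices p) j)
    edges i j (inj₁ i+1≡j)          = Linked-lookup (linked p) i j i+1≡j
    edges i j (inj₂ (i+1≡len , j≡0)) = subst₂ Adj (sym vertᵢ≡v) (sym vertⱼ≡u) vu
      where
      vertᵢ≡v = last-lookup {L = vertices p} (last≡ p) i i+1≡len
      vertⱼ≡u = head-lookup {L = vertices p} (head≡ p) j j≡0

  Path-rotate : ∀ {u v x y} (p : Path u v) → Adj v u → ∀ A B → vertices p ≡ A ++ B →
                last A ≡ just x → head B ≡ just y → Path y x
  Path-rotate p vu A@(_ ∷ _) B@(_ ∷ _) eq lastA headB = record
    { vertices = B ++ A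
    ; unique   = Unique-++-comm A (subst Unique eq (unique p))
    ; linked   = Linked.++⁺ (Linked-++⁻ʳ A linkedAB)
                            (subst₂ (Maybe.Connected Adj) lastB headA (Maybe.just vu))
                            (Linked-++⁻ˡ A linkedAB)
    ; head≡    = headB
    ; last≡    = last-++ʳ B lastA
    ; 3≤length = subst (3 ≤_) (trans (cong length eq) (length-++-comm A B)) (3≤length p) }
    where
    linkedAB = subst (Linked Adj) eq (linked p)
    lastB = trans (sym (last≡ p)) (trans (cong last eq) (last-++-∷ A))
    headA = trans (sym (head≡ p)) (cong head eq)

  Path-shortcut : ∀ {u v} (p : Path u v) A {x y} B {z C} → vertices p ≡ A ++ x ∷ y ∷ B ++ z ∷ C →
                  Adj x z → 3 ≤ length (A ++ x ∷ z ∷ C) → ShorterPath p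
  Path-shortcut {v = v} p A {x} {y} B {z} {C} eq xz 3≤len = record
    { vertices = A ++ x ∷ z ∷ C
    ; unique   = AllPairs-deleteBlock A (y ∷ B) (subst Unique eq (unique p))
    ; linked   = Linked-shortcut A (subst (Linked Adj) eq (linked p)) xz
    ; head≡    = trans (head-++-∷ A) (trans (cong head (sym eq)) (head≡ p))
    ; last≡    = last≡′
    ; 3≤length = 3≤len }
    , subst (λ L → length (A ++ x ∷ z ∷ C) < length L) (sym eq) (length-deleteBlock-< A)
    where
    open ≡-Reasoning
    last≡′ : last (A ++ x ∷ z ∷ C) ≡ just v
    last≡′ = begin
      last (A ++ x ∷ z ∷ C)          ≡⟨ last-++-∷ A ⟩
      last (z ∷ C)                   ≡⟨ last-++-∷ (y ∷ B) ⟨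
      last (y ∷ B ++ z ∷ C)          ≡⟨ last-++-∷ A ⟨
      last (A ++ x ∷ y ∷ B ++ z ∷ C) ≡⟨ cong last eq ⟨
      last (vertices p)              ≡⟨ last≡ p ⟩
      just v                         ∎

  -- The two refuted splittings are those where the chord i j would be an edge of the cycle.
  chord<⇒ShorterPath : ∀ {u v} (p : Path u v) {i j : Fin (size p)} → toℕ i < toℕ j →
                       ¬ Consec G (size p) i j → ¬ Consec G (size p) j i →
                       Adj (lookup (vertices p) i) (lookup (vertices p) j) → ShorterPath p
  chord<⇒ShorterPath p {i} {j} i<j ¬i→j ¬j→i ij with split-at-< (vertices p) i j i<j
  ... | _ , [] , _ , _ , _ , j≡ , _ =
    ⊥-elim (¬i→j (inj₁ (sym (trans j≡ (cong suc (+-identityʳ _))))))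
  ... | [] , _ ∷ _ , [] , _ , i≡ , _ , len≡ =
    ⊥-elim (¬j→i (inj₂ (sym (trans len≡ (cong suc (+-identityʳ _))) , i≡)))
  ... | a ∷ A , _ ∷ B , _ , eq , _ =
    Path-shortcut p (a ∷ A) B eq ij (s≤s (≤-trans (s≤s (s≤s z≤n)) (length-++-≤ʳ _ {A})))
  ... | [] , _ ∷ B , _ ∷ _ , eq , _ =
    Path-shortcut p [] B eq ij (s≤s (s≤s (s≤s z≤n)))

  chord⇒ShorterPath : ∀ {u v} (p : Path u v) (vu : Adj v u) →
                      HasChord G (Path⇒Cycle p vu) → ShorterPath p
  chord⇒ShorterPath p _ (i , j , i≢j , ¬i→j , ¬j→i , ij) with <-cmp (toℕ i) (toℕ j)
  ... | tri< i<j _ _ = chord<⇒ShorterPath p i<j ¬i→j ¬j→i ij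
  ... | tri≈ _ i≡j _ = ⊥-elim (i≢j (toℕ-injective i≡j))
  ... | tri> _ _ j<i = chord<⇒ShorterPath p j<i ¬j→i ¬i→j (Adj-sym ij)

  Chordal⇒CommonNeighbour : Chordal G → ∀ {u v} → Path u v → Adj v u → CommonNeighbour u v
  Chordal⇒CommonNeighbour chordal p = go p (<-wellFounded (size p))
    where
    go : ∀ {u v} (p : Path u v) → Acc _<_ (size p) → Adj v u → CommonNeighbour u v
    go record { vertices = _ ∷ [] ; 3≤length = s≤s () } _ _
    go record { vertices = _ ∷ _ ∷ [] ; 3≤length = s≤s (s≤s ()) } _ _
    go record { vertices = _ ∷ y ∷ _ ∷ [] ; linked = uy ∷ yv ∷ [-] ; head≡ = refl ; last≡ = refl } _ _ =
      y , uy , Adj-sym yv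
    go p@record { vertices = _ ∷ _ ∷ _ ∷ _ ∷ _ } (acc shorter) vu
      with q , q<p ← chord⇒ShorterPath p vu
                       (chordal (Path⇒Cycle p vu) (s≤s (s≤s (s≤s (s≤s z≤n))))) =
      go q (shorter q<p) vu

  Consec⇒Path : (C : Cycle G) → ∀ {i j} → Consec G (Cycle.len C) i j →
                Path (Cycle.vert C j) (Cycle.vert C i)
  Consec⇒Path record { len = suc m ; len≥3 = len≥3 ; vert = f ; inj = inj ; edges = edges } = consec⇒path
    where
    pathTo : ∀ i → suc (toℕ i) ≡ suc m → Path (f zero) (f i)
    pathTo i i+1≡ = record
      { vertices = tabulate f ; unique = tabulate⁺ inj
      ; linked   = Linked-tabulate (λ i j i+1≡j → edges i j (inj₁ i+1≡j))
      ; head≡    = refl ; last≡ = last-tabulate f i i+1≡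
      ; 3≤length = subst (3 ≤_) (sym (length-tabulate f)) len≥3 }

    last+1≡ : suc (toℕ (fromℕ m)) ≡ suc m
    last+1≡ = cong suc (toℕ-fromℕ m)

    consec⇒path : ∀ {i j} → Consec G (suc m) i j → Path (f j) (f i)
    consec⇒path {i} {j} (inj₁ i+1≡j) with A , B , eq , lastA , headB ← tabulate-split f i j i+1≡j =
      Path-rotate (pathTo (fromℕ m) last+1≡) (edges _ _ (inj₂ (last+1≡ , refl))) A B eq lastA headB
    consec⇒path {i} {zero} (inj₂ (i+1≡ , _)) = pathTo i i+1≡

  EdgeOnCycle⇒CommonNeighbour : Chordal G → ∀ {x y} (C : Cycle G) → EdgeOnCycle G x y C →
                                CommonNeighbour x y
  EdgeOnCycle⇒CommonNeighbour chordal C (i , j , i→j , ends)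
    with w , jw , iw ← Chordal⇒CommonNeighbour chordal (Consec⇒Path C i→j) (Cycle.edges C i j i→j)
    with ends
  ... | inj₁ (refl , refl) = w , iw , jw
  ... | inj₂ (refl , refl) = w , jw , iw

  -- Not being a bridge only refutes the absence of a cycle; decidability of having a
  -- common neighbour recovers an actual witness.
  nonBridge⇒CommonNeighbour : Chordal G → ∀ {x y} → Adj x y → ¬ IsBridge G x y → CommonNeighbour x y
  nonBridge⇒CommonNeighbour chordal {x} {y} xy notBridge with commonNeighbour? x y
  ... | yes common = common
  ... | no ¬common =
    ⊥-elim (notBridge (xy , λ (C , onC) → ¬common (EdgeOnCycle⇒CommonNeighbour chordal C onC)))

  isolated⇒ComponentIsClique : ∀ {v} → (∀ u → ¬ Adj v u) → ComponentIsClique G v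
  isolated⇒ComponentIsClique {v} isolated x y vx vy x≢y = ⊥-elim (x≢y (trans (sym (only vx)) (only vy)))
    where
    only : ∀ {x} → Connected G v x → v ≡ x
    only ε        = refl
    only (vu ◅ _) = ⊥-elim (isolated _ vu)

  TEdge : Subset n → Fin n → Fin n → Set
  TEdge T v u = Adj v u × (v ∈ T ⊎ u ∈ T)

  TEdge-incident : ∀ {T} → NoComponentIsClique G → Dominated G T → ∀ v → ∃[ u ] TEdge T v u
  TEdge-incident {T} noClique dominated v with v ∈? T
  ... | no v∉T with u , vu , u∈T ← dominated v v∉T = u , vu , inj₂ u∈T
  ... | yes v∈T with any? (adj? v)
  ...   | yes (u , vu) = u , vu , inj₁ v∈T
  ...   | no isolated  =
    ⊥-elim (noClique v (isolated⇒ComponentIsClique (λ u vu → isolated (u , vu))))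

lemma24 : (n : ℕ) (G : Graph n) (T : Subset n)
          → Chordal G
          → NoComponentIsClique G
          → ¬ HasBridge G
          → Dominated G T
          → ∀ v → InTTriangle G T v
lemma24 n G T chordal noClique noBridge dominated v
  with u , vu , v∨u∈T ← TEdge-incident G noClique dominated v
  with w , vw , uw ← nonBridge⇒CommonNeighbour G chordal vu (λ bridge → noBridge (v , u , bridge))
  = u , w , vu , vw , uw , map₂ inj₁ v∨u∈T
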